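{- Let $MB_4$ be the $4$-dimensional modified bubble-sort graph and let $F\subset V(MB_4)$ with $|F|\le 7$. If $MB_4-F$ is disconnected, then $MB_4-F$ has a component $C$ with $|V(C)|\ge 4!-|F|-3$.
   Context: $Sym(4)$ is the symmetric group on $\{1,2,3,4\}$. The modified bubble-sort graph $MB_4$ is the Cayley graph $Cay(Sym(4),\mathcal{T})$ with $\mathcal{T}=\{(1\,2),(2\,3),(3\,4),(1\,4)\}$: its vertex set is $Sym(4)$, and $g$, $g\cdot t$ are adjacent for every $g\in Sym(4)$, $t\in\mathcal{T}$. For $F\subseteq V(G)$, $G-F$ denotes the graph obtained from $G$ by deleting the vertices of $F$. -}

module Defs where

open import Data.Nat using (ℕ; _≤_)
open import Data.Product using (Σ; _×_)
open import Relation.Binary.PropositionalEquality using (_≡_)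
open import Data.List.Relation.Unary.All using (All)
open import Data.Fin using (Fin; zero; suc)
open import Data.Vec using (Vec; tabulate; lookup; toList)
open import Data.List using (List; _∷_; []; length)
open import Data.List.Relation.Unary.Unique.Propositional using (Unique)
open import Data.List.Membership.Propositional using (_∈_)
open import Data.Fin.Permutation.Components using (transpose)
open import Relation.Nullary using (¬_)

-- A permutation of {1,2,3,4} in one-line notation (0-indexed): g i = lookup g i.
-- The vertex set Sym(4) consists of vectors whose entries are pairwise distinct.
Word : Set
Word = Vec (Fin 4) 4

IsPerm : Word → Set
IsPerm g = Unique (toList g)

_·⟨_,_⟩ : Word → Fin 4 → Fin 4 → Word
g ·⟨ a , b ⟩ = tabulate (λ i → lookup g (transpose a b i))

-- Generating set T = {(1 2), (2 3), (3 4), (1 4)} (in 0-indexed positions).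
data Gen : Fin 4 → Fin 4 → Set where
  t12 : Gen zero (suc zero)
  t23 : Gen (suc zero) (suc (suc zero))
  t34 : Gen (suc (suc zero)) (suc (suc (suc zero)))
  t14 : Gen zero (suc (suc (suc zero)))

-- Adjacency in MB_4 = Cay(Sym(4), T): h = g · t for some t ∈ T, or vice versa.
-- (T consists of involutions, so this relation is symmetric.)
data Adj (g h : Word) : Set where
  adj : ∀ {a b} → Gen a b → h ≡ g ·⟨ a , b ⟩ → Adj g h

InGraph : List Word → Word → Set
InGraph F g = IsPerm g × ¬ (g ∈ F)

data Reach (F : List Word) (u : Word) : Word → Set where
  here : InGraph F u → Reach F u u
  step : ∀ {v w} → Reach F u v → Adj v w → InGraph F w → Reach F u w

Disconnected : List Word → Set
Disconnected F = Σ Word λ u → Σ Word λ v →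
  InGraph F u × InGraph F v × ¬ Reach F u v

ComponentSize≥ : List Word → Word → ℕ → Set
ComponentSize≥ F u k = Σ (List Word) λ C →
  Unique C × All (Reach F u) C × k ≤ length C

module Submission where

-- MB₄ is a 4-regular Cayley graph on 24 vertices. Left translations act transitively on its
-- vertices, and together with conjugation by the involutions c with c T c = T (the symmetries of
-- the 4-cycle (1 2), (2 3), (3 4), (1 4)) also on its edges. So if F contains an edge we may assume
-- it is {e, (1 2)}; otherwise F is independent, we may assume e ∈ F, and then F avoids the four
-- neighbours of e. What remains is finite: for every choice of the at most 5 (resp. 6, pairwise
-- non-adjacent) further vertices of F, a depth-first search finds at least 21 − |F| vertices in
-- one component of MB₄ − F.

open import Defs

open import Data.Bool using (Bool; true; false; T; not; _∧_; _∨_; if_then_else_)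
open import Data.Bool.ListAction using (any)
open import Data.Bool.Properties using (T-∧; T-∨; T-not-≡; T-≡)
open import Data.Empty using (⊥-elim)
open import Data.Fin using (#_)
import Data.Fin.Properties as Fin
open import Data.Fin.Patterns using (0F; 1F; 2F; 3F)
open import Data.List using (List; []; _∷_; _++_; length; map; filter)
open import Data.List.Properties using (length-map; length-++; map-∘; map-cong; map-id)
open import Data.List.Membership.Propositional using (_∈_; _∉_; find; lose)
open import Data.List.Membership.Propositional.Properties
  using (∈-map⁺; ∈-map⁻; ∈-filter⁺; ∈-filter⁻; ∈-++⁺ˡ; ∈-++⁺ʳ; ∈-++⁻; ∈-∃++; ∈-lookup)
import Data.List.Membership.DecPropositional as DecMembership
open import Data.List.Relation.Binary.Permutation.Propositional using (_↭_; ↭-sym)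
open import Data.List.Relation.Binary.Permutation.Propositional.Properties using (∈-resp-↭; ↭-length; shift)
open import Data.List.Relation.Binary.Sublist.Propositional
  using ([]; _∷_; _∷ʳ_) renaming (_⊆_ to _⊑_; ⊆-refl to ⊑-refl)
open import Data.List.Relation.Binary.Sublist.Propositional.Properties
  using (All-resp-⊆) renaming (filter-⊆ to filter-⊑; ++⁺ to ++⁺-⊑)
open import Data.List.Relation.Binary.Subset.Propositional using (_⊆_)
open import Data.List.Relation.Unary.All as All using (All; []; _∷_; all?)
import Data.List.Relation.Unary.All.Properties as All
open import Data.List.Relation.Unary.AllPairs using ([]; _∷_)
open import Data.List.Relation.Unary.Any using (Any; here; there; any?)
open import Data.List.Relation.Unary.Any.Properties using (any⁻)
open import Data.List.Relation.Unary.Unique.Propositional using (Unique)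
import Data.List.Relation.Unary.Unique.Propositional.Properties as Unique
import Data.List.Relation.Unary.Unique.DecPropositional as DecUnique
open import Data.Nat using (ℕ; zero; suc; _+_; _∸_; _≤_; _≤ᵇ_; _!; z≤n; s≤s)
open import Data.Nat.Properties
  using (≤-trans; ≤-reflexive; +-comm; +-suc; +-monoʳ-≤; +-cancelʳ-≤; ≤ᵇ⇒≤; m≤n+o⇒m∸n≤o; ∸-+-assoc; module ≤-Reasoning)
open import Data.Product using (Σ; Σ-syntax; _×_; _,_; proj₁; proj₂)
open import Data.Sum using (_⊎_; inj₁; inj₂)
open import Data.Unit using (⊤; tt)
open import Data.Vec using ([]; _∷_; tabulate; lookup; toList)
open import Data.Vec.Properties using (≡-dec)
open import Function using (_∘_; id; Equivalence)
open import Relation.Binary.Definitions using (DecidableEquality)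
open import Relation.Binary.PropositionalEquality using (_≡_; refl; sym; trans; cong; subst; subst₂)
open import Relation.Nullary using (Dec; yes; no)
open import Relation.Nullary.Decidable using (map′; from-yes; fromWitness; isYes; _×-dec_; _⊎-dec_; _→-dec_; T?)

unique-⊆-length≤ : ∀ {A : Set} {xs ys : List A} → Unique xs → xs ⊆ ys → length xs ≤ length ys
unique-⊆-length≤ {xs = []} _ _ = z≤n
unique-⊆-length≤ {xs = x ∷ xs} (x∉xs ∷ uniq) xs⊆ys with ∈-∃++ (xs⊆ys (here refl))
... | zs , ws , refl = ≤-trans (s≤s (unique-⊆-length≤ uniq xs⊆zs++ws)) (≤-reflexive (sym length-insert))
  where
    xs⊆zs++ws : xs ⊆ zs ++ ws
    xs⊆zs++ws {y} y∈xs with ∈-++⁻ zs (xs⊆ys (there y∈xs))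
    ... | inj₁ y∈zs         = ∈-++⁺ˡ y∈zs
    ... | inj₂ (here refl)  = ⊥-elim (All.lookup x∉xs y∈xs refl)
    ... | inj₂ (there y∈ws) = ∈-++⁺ʳ zs y∈ws
    length-insert : length (zs ++ x ∷ ws) ≡ suc (length (zs ++ ws))
    length-insert = trans (length-++ zs) (trans (+-suc (length zs) (length ws)) (cong suc (sym (length-++ zs))))

Unique-resp-⊑ : ∀ {A : Set} {xs ys : List A} → xs ⊑ ys → Unique ys → Unique xs
Unique-resp-⊑ []             []             = []
Unique-resp-⊑ (_ ∷ʳ xs⊑ys)   (_ ∷ uniq)     = Unique-resp-⊑ xs⊑ys uniq
Unique-resp-⊑ (refl ∷ xs⊑ys) (x∉ys ∷ uniq) = All-resp-⊆ xs⊑ys x∉ys ∷ Unique-resp-⊑ xs⊑ys uniq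

T-if : ∀ c {b} → T (if c then b else true) → T c → T b
T-if true b-holds _ = b-holds

record Marking (V : Set) : Set₁ where
  field
    Mark        : Set
    marked      : V → Mark → Bool
    mark        : V → Mark → Mark
    marked-mark : ∀ x m → T (marked x (mark x m))
    marked-mono : ∀ x m {y} → T (marked y m) → T (marked y (mark x m))

module Graph {V : Set} (nbs : V → List V) where

  data Reachable (S : List V) (u : V) : V → Set where
    start : u ∉ S → Reachable S u u
    step  : ∀ {v w} → Reachable S u v → w ∈ nbs v → w ∉ S → Reachable S u w

  -- G − S has a component with at least k − |S| vertices (stated without truncated subtraction).
  LargeComponent : ℕ → List V → Set
  LargeComponent k S =
    Σ[ u ∈ V ] u ∉ S × Σ[ C ∈ List V ] Unique C × All (Reachable S u) C × k ≤ length C + length S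

  Independent : List V → Set
  Independent S = ∀ {a b} → a ∈ S → b ∈ S → b ∉ nbs a

  Reachable-resp-⊇ : ∀ {S S′ u w} → S′ ⊆ S → Reachable S u w → Reachable S′ u w
  Reachable-resp-⊇ S′⊆S (start u∉S)        = start (u∉S ∘ S′⊆S)
  Reachable-resp-⊇ S′⊆S (step r w∈nbs w∉S) = step (Reachable-resp-⊇ S′⊆S r) w∈nbs (w∉S ∘ S′⊆S)

  largeComponent-⊆ : ∀ {k S S′} → S′ ⊆ S → length S ≤ length S′ → LargeComponent k S → LargeComponent k S′
  largeComponent-⊆ S′⊆S |S|≤|S′| (u , u∉S , C , uniq , reach , k≤) =
    u , u∉S ∘ S′⊆S , C , uniq , All.map (Reachable-resp-⊇ S′⊆S) reach ,
    ≤-trans k≤ (+-monoʳ-≤ (length C) |S|≤|S′|)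

  largeComponent-↭ : ∀ {k S S′} → S ↭ S′ → LargeComponent k S → LargeComponent k S′
  largeComponent-↭ S↭S′ = largeComponent-⊆ (∈-resp-↭ (↭-sym S↭S′)) (≤-reflexive (↭-length S↭S′))

  Independent-resp-⊇ : ∀ {S S′} → S′ ⊆ S → Independent S → Independent S′
  Independent-resp-⊇ S′⊆S indep a∈S′ b∈S′ = indep (S′⊆S a∈S′) (S′⊆S b∈S′)

  record Symmetry : Set where
    field
      to from  : V → V
      from-to  : ∀ x → from (to x) ≡ x
      to-from  : ∀ x → to (from x) ≡ x
      to-adj   : ∀ {v w} → w ∈ nbs v → to w ∈ nbs (to v)
      from-adj : ∀ {v w} → w ∈ nbs v → from w ∈ nbs (from v)

  _∘ˢ_ : Symmetry → Symmetry → Symmetry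
  σ ∘ˢ τ = record
    { to       = to σ ∘ to τ
    ; from     = from τ ∘ from σ
    ; from-to  = λ x → trans (cong (from τ) (from-to σ (to τ x))) (from-to τ x)
    ; to-from  = λ x → trans (cong (to σ) (to-from τ (from σ x))) (to-from σ x)
    ; to-adj   = to-adj σ ∘ to-adj τ
    ; from-adj = from-adj τ ∘ from-adj σ
    }
    where open Symmetry

  module _ (σ : Symmetry) where
    open Symmetry σ

    from-injective : ∀ {x y} → from x ≡ from y → x ≡ y
    from-injective {x} {y} eq = trans (sym (to-from x)) (trans (cong to eq) (to-from y))

    from-∉ : ∀ {S w} → w ∉ S → from w ∉ map from S
    from-∉ {S} w∉S fw∈ with ∈-map⁻ from fw∈
    ... | x , x∈S , eq = w∉S (subst (_∈ S) (sym (from-injective eq)) x∈S)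

    Reachable-from : ∀ {S u w} → Reachable S u w → Reachable (map from S) (from u) (from w)
    Reachable-from (start u∉S)        = start (from-∉ u∉S)
    Reachable-from (step r w∈nbs w∉S) = step (Reachable-from r) (from-adj w∈nbs) (from-∉ w∉S)

    largeComponent-from : ∀ {k S} → LargeComponent k S → LargeComponent k (map from S)
    largeComponent-from {k} {S} (u , u∉S , C , uniq , reach , k≤) =
      from u , from-∉ u∉S , map from C , Unique.map⁺ from-injective uniq ,
      All.map⁺ (All.map Reachable-from reach) ,
      subst₂ (λ c s → k ≤ c + s) (sym (length-map from C)) (sym (length-map from S)) k≤

    largeComponent-pull : ∀ {k S} → LargeComponent k (map to S) → LargeComponent k S
    largeComponent-pull {k} {S} large = subst (LargeComponent k) from-to-S (largeComponent-from large)
      where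
        from-to-S : map from (map to S) ≡ S
        from-to-S = trans (sym (map-∘ S)) (trans (map-cong from-to S) (map-id S))

    ∈-map-to : ∀ {S x y} → x ∈ S → to x ≡ y → y ∈ map to S
    ∈-map-to x∈S refl = ∈-map⁺ to x∈S

    Independent-to : ∀ {S} → Independent S → Independent (map to S)
    Independent-to {S} indep a′∈ b′∈ b′∈nbs with ∈-map⁻ to a′∈ | ∈-map⁻ to b′∈
    ... | a , a∈S , refl | b , b∈S , refl =
      indep a∈S b∈S (subst₂ (λ x y → y ∈ nbs x) (from-to a) (from-to b) (from-adj b′∈nbs))

  module _ (_≟_ : DecidableEquality V) where
    open DecMembership _≟_ using (_∈?_)

    edge-or-independent : ∀ S → (Σ[ a ∈ V ] Σ[ b ∈ V ] a ∈ S × b ∈ S × b ∈ nbs a) ⊎ Independent S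
    edge-or-independent S with any? (λ a → any? (λ b → b ∈? nbs a) S) S
    ... | yes edge = let a , a∈S , b-edge = find edge ; b , b∈S , b∈nbs = find b-edge in
                     inj₁ (a , b , a∈S , b∈S , b∈nbs)
    ... | no ¬edge = inj₂ λ a∈S b∈S b∈nbs → ¬edge (lose a∈S (lose b∈S b∈nbs))

    selection : ∀ {S} cands acc → Unique (cands ++ acc) → acc ⊆ S → S ⊆ cands ++ acc →
                let T = filter (_∈? S) cands in
                T ⊑ cands × T ++ acc ⊆ S × S ⊆ T ++ acc × length (T ++ acc) ≤ length S
    selection {S} cands acc uniq acc⊆S S⊆cands++acc =
      filter-⊑ (_∈? S) cands , T++acc⊆S , S⊆T++acc ,
      unique-⊆-length≤ (Unique-resp-⊑ (++⁺-⊑ (filter-⊑ (_∈? S) cands) ⊑-refl) uniq) T++acc⊆S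
      where
        T++acc⊆S : filter (_∈? S) cands ++ acc ⊆ S
        T++acc⊆S y∈ with ∈-++⁻ (filter (_∈? S) cands) y∈
        ... | inj₁ y∈T   = proj₂ (∈-filter⁻ (_∈? S) {xs = cands} y∈T)
        ... | inj₂ y∈acc = acc⊆S y∈acc
        S⊆T++acc : S ⊆ filter (_∈? S) cands ++ acc
        S⊆T++acc y∈S with ∈-++⁻ cands (S⊆cands++acc y∈S)
        ... | inj₁ y∈cands = ∈-++⁺ˡ (∈-filter⁺ (_∈? S) y∈cands y∈S)
        ... | inj₂ y∈acc   = ∈-++⁺ʳ _ y∈acc

    module Search (M : Marking V) (vertices : List V) (k : ℕ) where
      open Marking M

      Marks : List V → Mark → Set
      Marks S m = All (λ y → T (marked y m)) S

      unmarked-∉ : ∀ {S m x} → Marks S m → marked x m ≡ false → x ∉ S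
      unmarked-∉ S-marked x-unmarked x∈S = subst T x-unmarked (All.lookup S-marked x∈S)

      record State : Set where
        constructor state
        field
          stack : List V
          marks : Mark
          found : List V

      visit : List V → State → State
      visit []       s = s
      visit (x ∷ xs) (state ys m found) =
        if marked x m then visit xs (state ys m found) else visit xs (state (x ∷ ys) (mark x m) (x ∷ found))

      explore : ℕ → State → List V
      explore zero    s                       = State.found s
      explore (suc n) (state []       m found) = found
      explore (suc n) (state (x ∷ ys) m found) = explore n (visit (nbs x) (state ys m found))

      -- Depth-first search from u avoiding marked vertices; each round pops one of at most |vertices| pushed vertices.
      component : Mark → V → List V
      component m u = explore (length vertices) (state (u ∷ []) (mark u m) (u ∷ []))

      record Invariant (S : List V) (u : V) (s : State) : Set where
        field
          removed-marked  : Marks S (State.marks s)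
          found-marked    : Marks (State.found s) (State.marks s)
          found-unique    : Unique (State.found s)
          found-reachable : All (Reachable S u) (State.found s)
          stack-reachable : All (Reachable S u) (State.stack s)

      visit-invariant : ∀ {S u z s} xs → Reachable S u z → xs ⊆ nbs z → Invariant S u s → Invariant S u (visit xs s)
      visit-invariant [] _ _ inv = inv
      visit-invariant {S} {u} {s = state ys m found} (x ∷ xs) z-reachable xs⊆nbs inv with marked x m in x-marked
      ... | true  = visit-invariant xs z-reachable (xs⊆nbs ∘ there) inv
      ... | false = visit-invariant xs z-reachable (xs⊆nbs ∘ there) inv′
        where
          open Invariant inv
          x-reachable : Reachable S u x
          x-reachable = step z-reachable (xs⊆nbs (here refl)) (unmarked-∉ removed-marked x-marked)
          inv′ : Invariant S u (state (x ∷ ys) (mark x m) (x ∷ found))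
          inv′ = record
            { removed-marked  = All.map (marked-mono x m) removed-marked
            ; found-marked    = marked-mark x m ∷ All.map (marked-mono x m) found-marked
            ; found-unique    = All.tabulate (λ y∈found x≡y → unmarked-∉ found-marked x-marked (subst (_∈ found) (sym x≡y) y∈found))
                                ∷ found-unique
            ; found-reachable = x-reachable ∷ found-reachable
            ; stack-reachable = x-reachable ∷ stack-reachable
            }

      explore-sound : ∀ {S u} n s → Invariant S u s → Unique (explore n s) × All (Reachable S u) (explore n s)
      explore-sound zero    s                        inv = Invariant.found-unique inv , Invariant.found-reachable inv
      explore-sound (suc n) (state []       m found) inv = Invariant.found-unique inv , Invariant.found-reachable inv
      explore-sound (suc n) (state (x ∷ ys) m found) inv with Invariant.stack-reachable inv
      ... | x-reachable ∷ ys-reachable =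
        explore-sound n _ (visit-invariant (nbs x) x-reachable id (record
          { removed-marked  = removed-marked
          ; found-marked    = found-marked
          ; found-unique    = found-unique
          ; found-reachable = found-reachable
          ; stack-reachable = ys-reachable
          }))
        where open Invariant inv

      component-sound : ∀ {S m u} → Marks S m → marked u m ≡ false →
                        Unique (component m u) × All (Reachable S u) (component m u)
      component-sound {S} {m} {u} S-marked u-unmarked = explore-sound (length vertices) _ (record
        { removed-marked  = All.map (marked-mono u m) S-marked
        ; found-marked    = marked-mark u m ∷ []
        ; found-unique    = [] ∷ []
        ; found-reachable = start u∉S ∷ []
        ; stack-reachable = start u∉S ∷ []
        })
        where u∉S = unmarked-∉ S-marked u-unmarked

      largeComponentᵇ : List V → Mark → Bool
      largeComponentᵇ S m = any (λ u → not (marked u m) ∧ (k ≤ᵇ length (component m u) + length S)) vertices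

      largeComponentᵇ-sound : ∀ {S m} → Marks S m → T (largeComponentᵇ S m) → LargeComponent k S
      largeComponentᵇ-sound {S} {m} S-marked found-large
        with find (any⁻ (λ u → not (marked u m) ∧ (k ≤ᵇ length (component m u) + length S)) vertices found-large)
      ... | u , _ , large with Equivalence.to T-∧ large
      ...   | u-unmarked , k≤ =
        let u-unmarked′ = Equivalence.to T-not-≡ u-unmarked
            uniq , reach = component-sound S-marked u-unmarked′
        in u , unmarked-∉ S-marked u-unmarked′ , component m u , uniq , reach , ≤ᵇ⇒≤ k _ k≤

      module _ (compatible : V → List V → Bool) where

        allExtensionsᵇ : List V → ℕ → List V → Mark → Bool
        allExtensionsᵇ []       _       acc m = largeComponentᵇ acc m
        allExtensionsᵇ (_ ∷ _)  zero    acc m = largeComponentᵇ acc m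
        allExtensionsᵇ (x ∷ xs) (suc b) acc m =
          allExtensionsᵇ xs (suc b) acc m ∧
          (if compatible x acc then allExtensionsᵇ xs b (x ∷ acc) (mark x m) else true)

        -- Checking refl against ≡ uses the fast evaluator (tt against T does not), and a named
        -- proposition keeps the conversion checker from re-running the search when such a fact is passed on.
        Verified : List V → ℕ → List V → Mark → Set
        Verified xs b acc m = allExtensionsᵇ xs b acc m ≡ true

        module _ {P : List V → Set} (P-resp-⊇ : ∀ {X Y} → Y ⊆ X → P X → P Y)
                 (P⇒compatible : ∀ {x acc} → P (x ∷ acc) → T (compatible x acc)) where

          allExtensionsᵇ-sound : ∀ xs b acc m → Marks acc m → T (allExtensionsᵇ xs b acc m) →
                                 ∀ {ys} → ys ⊑ xs → length ys ≤ b → P (ys ++ acc) → LargeComponent k (ys ++ acc)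
          allExtensionsᵇ-sound [] b acc m acc-marked ok [] _ _ = largeComponentᵇ-sound acc-marked ok
          allExtensionsᵇ-sound (x ∷ xs) zero acc m acc-marked ok {[]} _ _ _ = largeComponentᵇ-sound acc-marked ok
          allExtensionsᵇ-sound (x ∷ xs) (suc b) acc m acc-marked ok (.x ∷ʳ ys⊑xs) |ys|≤ P-ys =
            allExtensionsᵇ-sound xs (suc b) acc m acc-marked (proj₁ (Equivalence.to T-∧ ok)) ys⊑xs |ys|≤ P-ys
          allExtensionsᵇ-sound (x ∷ xs) (suc b) acc m acc-marked ok {.x ∷ ys} (refl ∷ ys⊑xs) (s≤s |ys|≤b) P-x∷ys =
            largeComponent-↭ (shift x ys acc)
              (allExtensionsᵇ-sound xs b (x ∷ acc) (mark x m)
                 (marked-mark x m ∷ All.map (marked-mono x m) acc-marked) ok′ ys⊑xs |ys|≤b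
                 (P-resp-⊇ (∈-resp-↭ (shift x ys acc)) P-x∷ys))
            where
              x∷acc⊆ : x ∷ acc ⊆ x ∷ ys ++ acc
              x∷acc⊆ (here refl)   = here refl
              x∷acc⊆ (there y∈acc) = there (∈-++⁺ʳ ys y∈acc)
              ok′ : T (allExtensionsᵇ xs b (x ∷ acc) (mark x m))
              ok′ = T-if (compatible x acc) (proj₂ (Equivalence.to T-∧ ok))
                      (P⇒compatible (P-resp-⊇ x∷acc⊆ P-x∷ys))

          search-sound : ∀ {S} cands acc m b → Unique (cands ++ acc) → Marks acc m →
                         Verified cands b acc m →
                         acc ⊆ S → S ⊆ cands ++ acc → length S ≤ b + length acc → P S → LargeComponent k S
          search-sound {S} cands acc m b uniq acc-marked ok acc⊆S S⊆ |S|≤ P-S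
            with selection cands acc uniq acc⊆S S⊆
          ... | T⊑cands , T++acc⊆S , S⊆T++acc , |T++acc|≤|S| =
            largeComponent-⊆ S⊆T++acc |T++acc|≤|S|
              (allExtensionsᵇ-sound cands b acc m acc-marked (Equivalence.from T-≡ ok) T⊑cands |T|≤b (P-resp-⊇ T++acc⊆S P-S))
            where
              |T|≤b : length (filter (_∈? S) cands) ≤ b
              |T|≤b = +-cancelʳ-≤ (length acc) _ b
                        (≤-trans (≤-reflexive (sym (length-++ (filter (_∈? S) cands)))) (≤-trans |T++acc|≤|S| |S|≤))

pattern ⟨_,_,_,_⟩ a b c d = a ∷ b ∷ c ∷ d ∷ []

data V : Set where
  v0 v1 v2 v3 v4 v5 v6 v7 v8 v9 v10 v11 v12 v13 v14 v15 v16 v17 v18 v19 v20 v21 v22 v23 : V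

perm : V → Word
perm v0 = ⟨ 0F , 1F , 2F , 3F ⟩
perm v1 = ⟨ 0F , 1F , 3F , 2F ⟩
perm v2 = ⟨ 0F , 2F , 1F , 3F ⟩
perm v3 = ⟨ 0F , 2F , 3F , 1F ⟩
perm v4 = ⟨ 0F , 3F , 1F , 2F ⟩
perm v5 = ⟨ 0F , 3F , 2F , 1F ⟩
perm v6 = ⟨ 1F , 0F , 2F , 3F ⟩
perm v7 = ⟨ 1F , 0F , 3F , 2F ⟩
perm v8 = ⟨ 1F , 2F , 0F , 3F ⟩
perm v9 = ⟨ 1F , 2F , 3F , 0F ⟩
perm v10 = ⟨ 1F , 3F , 0F , 2F ⟩
perm v11 = ⟨ 1F , 3F , 2F , 0F ⟩
perm v12 = ⟨ 2F , 0F , 1F , 3F ⟩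
perm v13 = ⟨ 2F , 0F , 3F , 1F ⟩
perm v14 = ⟨ 2F , 1F , 0F , 3F ⟩
perm v15 = ⟨ 2F , 1F , 3F , 0F ⟩
perm v16 = ⟨ 2F , 3F , 0F , 1F ⟩
perm v17 = ⟨ 2F , 3F , 1F , 0F ⟩
perm v18 = ⟨ 3F , 0F , 1F , 2F ⟩
perm v19 = ⟨ 3F , 0F , 2F , 1F ⟩
perm v20 = ⟨ 3F , 1F , 0F , 2F ⟩
perm v21 = ⟨ 3F , 1F , 2F , 0F ⟩
perm v22 = ⟨ 3F , 2F , 0F , 1F ⟩
perm v23 = ⟨ 3F , 2F , 1F , 0F ⟩

rank : Word → V
rank ⟨ 0F , 1F , 2F , 3F ⟩ = v0
rank ⟨ 0F , 1F , 3F , 2F ⟩ = v1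
rank ⟨ 0F , 2F , 1F , 3F ⟩ = v2
rank ⟨ 0F , 2F , 3F , 1F ⟩ = v3
rank ⟨ 0F , 3F , 1F , 2F ⟩ = v4
rank ⟨ 0F , 3F , 2F , 1F ⟩ = v5
rank ⟨ 1F , 0F , 2F , 3F ⟩ = v6
rank ⟨ 1F , 0F , 3F , 2F ⟩ = v7
rank ⟨ 1F , 2F , 0F , 3F ⟩ = v8
rank ⟨ 1F , 2F , 3F , 0F ⟩ = v9
rank ⟨ 1F , 3F , 0F , 2F ⟩ = v10
rank ⟨ 1F , 3F , 2F , 0F ⟩ = v11
rank ⟨ 2F , 0F , 1F , 3F ⟩ = v12
rank ⟨ 2F , 0F , 3F , 1F ⟩ = v13
rank ⟨ 2F , 1F , 0F , 3F ⟩ = v14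
rank ⟨ 2F , 1F , 3F , 0F ⟩ = v15
rank ⟨ 2F , 3F , 0F , 1F ⟩ = v16
rank ⟨ 2F , 3F , 1F , 0F ⟩ = v17
rank ⟨ 3F , 0F , 1F , 2F ⟩ = v18
rank ⟨ 3F , 0F , 2F , 1F ⟩ = v19
rank ⟨ 3F , 1F , 0F , 2F ⟩ = v20
rank ⟨ 3F , 1F , 2F , 0F ⟩ = v21
rank ⟨ 3F , 2F , 0F , 1F ⟩ = v22
rank ⟨ 3F , 2F , 1F , 0F ⟩ = v23
rank _ = v0

rank-perm : ∀ v → rank (perm v) ≡ v
rank-perm v0 = refl
rank-perm v1 = refl
rank-perm v2 = refl
rank-perm v3 = refl
rank-perm v4 = refl
rank-perm v5 = refl
rank-perm v6 = refl
rank-perm v7 = refl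
rank-perm v8 = refl
rank-perm v9 = refl
rank-perm v10 = refl
rank-perm v11 = refl
rank-perm v12 = refl
rank-perm v13 = refl
rank-perm v14 = refl
rank-perm v15 = refl
rank-perm v16 = refl
rank-perm v17 = refl
rank-perm v18 = refl
rank-perm v19 = refl
rank-perm v20 = refl
rank-perm v21 = refl
rank-perm v22 = refl
rank-perm v23 = refl

perm-injective : ∀ {v w} → perm v ≡ perm w → v ≡ w
perm-injective {v} {w} eq = trans (sym (rank-perm v)) (trans (cong rank eq) (rank-perm w))

infix 4 _≟ʷ_
_≟ʷ_ : DecidableEquality Word
_≟ʷ_ = ≡-dec Fin._≟_

allV : List V
allV = v0 ∷ v1 ∷ v2 ∷ v3 ∷ v4 ∷ v5 ∷ v6 ∷ v7 ∷ v8 ∷ v9 ∷ v10 ∷ v11 ∷ v12 ∷ v13 ∷ v14 ∷ v15 ∷ v16 ∷ v17 ∷ v18 ∷ v19 ∷ v20 ∷ v21 ∷ v22 ∷ v23 ∷ []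

∈-allV : ∀ v → v ∈ allV
∈-allV v0 = ∈-lookup (# 0)
∈-allV v1 = ∈-lookup (# 1)
∈-allV v2 = ∈-lookup (# 2)
∈-allV v3 = ∈-lookup (# 3)
∈-allV v4 = ∈-lookup (# 4)
∈-allV v5 = ∈-lookup (# 5)
∈-allV v6 = ∈-lookup (# 6)
∈-allV v7 = ∈-lookup (# 7)
∈-allV v8 = ∈-lookup (# 8)
∈-allV v9 = ∈-lookup (# 9)
∈-allV v10 = ∈-lookup (# 10)
∈-allV v11 = ∈-lookup (# 11)
∈-allV v12 = ∈-lookup (# 12)
∈-allV v13 = ∈-lookup (# 13)
∈-allV v14 = ∈-lookup (# 14)
∈-allV v15 = ∈-lookup (# 15)
∈-allV v16 = ∈-lookup (# 16)
∈-allV v17 = ∈-lookup (# 17)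
∈-allV v18 = ∈-lookup (# 18)
∈-allV v19 = ∈-lookup (# 19)
∈-allV v20 = ∈-lookup (# 20)
∈-allV v21 = ∈-lookup (# 21)
∈-allV v22 = ∈-lookup (# 22)
∈-allV v23 = ∈-lookup (# 23)

-- A single case split, much faster in the search than comparing permutations.
_==_ : V → V → Bool
v0 == v0 = true
v1 == v1 = true
v2 == v2 = true
v3 == v3 = true
v4 == v4 = true
v5 == v5 = true
v6 == v6 = true
v7 == v7 = true
v8 == v8 = true
v9 == v9 = true
v10 == v10 = true
v11 == v11 = true
v12 == v12 = true
v13 == v13 = true
v14 == v14 = true
v15 == v15 = true
v16 == v16 = true
v17 == v17 = true
v18 == v18 = true
v19 == v19 = true
v20 == v20 = true
v21 == v21 = true
v22 == v22 = true
v23 == v23 = true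
_ == _ = false

-- Facts checked by evaluation are opaque, so that using them never re-evaluates them.
opaque
  ==⇒perm≡ : All (λ v → All (λ w → T (v == w) → perm v ≡ perm w) allV) allV
  ==⇒perm≡ = from-yes (all? (λ v → all? (λ w → T? (v == w) →-dec perm v ≟ʷ perm w) allV) allV)

  ==-refl : All (λ v → T (v == v)) allV
  ==-refl = from-yes (all? (λ v → T? (v == v)) allV)

infix 4 _≟_
_≟_ : DecidableEquality V
v ≟ w = map′ ==⇒≡ ≡⇒== (T? (v == w))
  where
    ==⇒≡ : T (v == w) → v ≡ w
    ==⇒≡ v==w = perm-injective (All.lookup (All.lookup ==⇒perm≡ (∈-allV v)) (∈-allV w) v==w)
    ≡⇒== : v ≡ w → T (v == w)
    ≡⇒== refl = All.lookup ==-refl (∈-allV v)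

open DecMembership _≟_ using (_∈?_; _∉?_)
open DecUnique _≟_ using (unique?)

opaque
  allV-unique : Unique allV
  allV-unique = from-yes (unique? allV)

-- vᵢ · t for the generators t = (0 1), (1 2), (2 3), (0 3), in this order.
nbs : V → List V
nbs v0 = v6 ∷ v2 ∷ v1 ∷ v21 ∷ []
nbs v1 = v7 ∷ v4 ∷ v0 ∷ v15 ∷ []
nbs v2 = v12 ∷ v0 ∷ v3 ∷ v23 ∷ []
nbs v3 = v13 ∷ v5 ∷ v2 ∷ v9 ∷ []
nbs v4 = v18 ∷ v1 ∷ v5 ∷ v17 ∷ []
nbs v5 = v19 ∷ v3 ∷ v4 ∷ v11 ∷ []
nbs v6 = v0 ∷ v8 ∷ v7 ∷ v19 ∷ []
nbs v7 = v1 ∷ v10 ∷ v6 ∷ v13 ∷ []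
nbs v8 = v14 ∷ v6 ∷ v9 ∷ v22 ∷ []
nbs v9 = v15 ∷ v11 ∷ v8 ∷ v3 ∷ []
nbs v10 = v20 ∷ v7 ∷ v11 ∷ v16 ∷ []
nbs v11 = v21 ∷ v9 ∷ v10 ∷ v5 ∷ []
nbs v12 = v2 ∷ v14 ∷ v13 ∷ v18 ∷ []
nbs v13 = v3 ∷ v16 ∷ v12 ∷ v7 ∷ []
nbs v14 = v8 ∷ v12 ∷ v15 ∷ v20 ∷ []
nbs v15 = v9 ∷ v17 ∷ v14 ∷ v1 ∷ []
nbs v16 = v22 ∷ v13 ∷ v17 ∷ v10 ∷ []
nbs v17 = v23 ∷ v15 ∷ v16 ∷ v4 ∷ []
nbs v18 = v4 ∷ v20 ∷ v19 ∷ v12 ∷ []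
nbs v19 = v5 ∷ v22 ∷ v18 ∷ v6 ∷ []
nbs v20 = v10 ∷ v18 ∷ v21 ∷ v14 ∷ []
nbs v21 = v11 ∷ v23 ∷ v20 ∷ v0 ∷ []
nbs v22 = v16 ∷ v19 ∷ v23 ∷ v8 ∷ []
nbs v23 = v17 ∷ v21 ∷ v22 ∷ v2 ∷ []

record VertexSet : Set where
  field
    b0 b1 b2 b3 b4 b5 b6 b7 b8 b9 b10 b11 b12 b13 b14 b15 b16 b17 b18 b19 b20 b21 b22 b23 : Bool

∅ : VertexSet
∅ = record { b0 = false ; b1 = false ; b2 = false ; b3 = false ; b4 = false ; b5 = false ; b6 = false ; b7 = false ; b8 = false ; b9 = false ; b10 = false ; b11 = false ; b12 = false ; b13 = false ; b14 = false ; b15 = false ; b16 = false ; b17 = false ; b18 = false ; b19 = false ; b20 = false ; b21 = false ; b22 = false ; b23 = false }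

_∈ᵇ_ : V → VertexSet → Bool
v0 ∈ᵇ s = VertexSet.b0 s
v1 ∈ᵇ s = VertexSet.b1 s
v2 ∈ᵇ s = VertexSet.b2 s
v3 ∈ᵇ s = VertexSet.b3 s
v4 ∈ᵇ s = VertexSet.b4 s
v5 ∈ᵇ s = VertexSet.b5 s
v6 ∈ᵇ s = VertexSet.b6 s
v7 ∈ᵇ s = VertexSet.b7 s
v8 ∈ᵇ s = VertexSet.b8 s
v9 ∈ᵇ s = VertexSet.b9 s
v10 ∈ᵇ s = VertexSet.b10 s
v11 ∈ᵇ s = VertexSet.b11 s
v12 ∈ᵇ s = VertexSet.b12 s
v13 ∈ᵇ s = VertexSet.b13 s
v14 ∈ᵇ s = VertexSet.b14 s
v15 ∈ᵇ s = VertexSet.b15 s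
v16 ∈ᵇ s = VertexSet.b16 s
v17 ∈ᵇ s = VertexSet.b17 s
v18 ∈ᵇ s = VertexSet.b18 s
v19 ∈ᵇ s = VertexSet.b19 s
v20 ∈ᵇ s = VertexSet.b20 s
v21 ∈ᵇ s = VertexSet.b21 s
v22 ∈ᵇ s = VertexSet.b22 s
v23 ∈ᵇ s = VertexSet.b23 s

insert : V → VertexSet → VertexSet
insert v0 s = record s { b0 = true }
insert v1 s = record s { b1 = true }
insert v2 s = record s { b2 = true }
insert v3 s = record s { b3 = true }
insert v4 s = record s { b4 = true }
insert v5 s = record s { b5 = true }
insert v6 s = record s { b6 = true }
insert v7 s = record s { b7 = true }
insert v8 s = record s { b8 = true }
insert v9 s = record s { b9 = true }
insert v10 s = record s { b10 = true }
insert v11 s = record s { b11 = true }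
insert v12 s = record s { b12 = true }
insert v13 s = record s { b13 = true }
insert v14 s = record s { b14 = true }
insert v15 s = record s { b15 = true }
insert v16 s = record s { b16 = true }
insert v17 s = record s { b17 = true }
insert v18 s = record s { b18 = true }
insert v19 s = record s { b19 = true }
insert v20 s = record s { b20 = true }
insert v21 s = record s { b21 = true }
insert v22 s = record s { b22 = true }
insert v23 s = record s { b23 = true }

_∪_ : VertexSet → VertexSet → VertexSet
s ∪ t = record
  { b0 = b0 s ∨ b0 t
  ; b1 = b1 s ∨ b1 t
  ; b2 = b2 s ∨ b2 t
  ; b3 = b3 s ∨ b3 t
  ; b4 = b4 s ∨ b4 t
  ; b5 = b5 s ∨ b5 t
  ; b6 = b6 s ∨ b6 t
  ; b7 = b7 s ∨ b7 t
  ; b8 = b8 s ∨ b8 t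
  ; b9 = b9 s ∨ b9 t
  ; b10 = b10 s ∨ b10 t
  ; b11 = b11 s ∨ b11 t
  ; b12 = b12 s ∨ b12 t
  ; b13 = b13 s ∨ b13 t
  ; b14 = b14 s ∨ b14 t
  ; b15 = b15 s ∨ b15 t
  ; b16 = b16 s ∨ b16 t
  ; b17 = b17 s ∨ b17 t
  ; b18 = b18 s ∨ b18 t
  ; b19 = b19 s ∨ b19 t
  ; b20 = b20 s ∨ b20 t
  ; b21 = b21 s ∨ b21 t
  ; b22 = b22 s ∨ b22 t
  ; b23 = b23 s ∨ b23 t
  }
  where open VertexSet

∈ᵇ-∪ : ∀ x s t → x ∈ᵇ (s ∪ t) ≡ x ∈ᵇ s ∨ x ∈ᵇ t
∈ᵇ-∪ v0 s t = refl
∈ᵇ-∪ v1 s t = refl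
∈ᵇ-∪ v2 s t = refl
∈ᵇ-∪ v3 s t = refl
∈ᵇ-∪ v4 s t = refl
∈ᵇ-∪ v5 s t = refl
∈ᵇ-∪ v6 s t = refl
∈ᵇ-∪ v7 s t = refl
∈ᵇ-∪ v8 s t = refl
∈ᵇ-∪ v9 s t = refl
∈ᵇ-∪ v10 s t = refl
∈ᵇ-∪ v11 s t = refl
∈ᵇ-∪ v12 s t = refl
∈ᵇ-∪ v13 s t = refl
∈ᵇ-∪ v14 s t = refl
∈ᵇ-∪ v15 s t = refl
∈ᵇ-∪ v16 s t = refl
∈ᵇ-∪ v17 s t = refl
∈ᵇ-∪ v18 s t = refl
∈ᵇ-∪ v19 s t = refl
∈ᵇ-∪ v20 s t = refl
∈ᵇ-∪ v21 s t = refl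
∈ᵇ-∪ v22 s t = refl
∈ᵇ-∪ v23 s t = refl

insert≡∪ : ∀ x s → insert x s ≡ insert x ∅ ∪ s
insert≡∪ v0 s = refl
insert≡∪ v1 s = refl
insert≡∪ v2 s = refl
insert≡∪ v3 s = refl
insert≡∪ v4 s = refl
insert≡∪ v5 s = refl
insert≡∪ v6 s = refl
insert≡∪ v7 s = refl
insert≡∪ v8 s = refl
insert≡∪ v9 s = refl
insert≡∪ v10 s = refl
insert≡∪ v11 s = refl
insert≡∪ v12 s = refl
insert≡∪ v13 s = refl
insert≡∪ v14 s = refl
insert≡∪ v15 s = refl
insert≡∪ v16 s = refl
insert≡∪ v17 s = refl
insert≡∪ v18 s = refl
insert≡∪ v19 s = refl
insert≡∪ v20 s = refl
insert≡∪ v21 s = refl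
insert≡∪ v22 s = refl
insert≡∪ v23 s = refl

opaque
  ∈ᵇ-singleton : All (λ x → T (x ∈ᵇ insert x ∅)) allV
  ∈ᵇ-singleton = from-yes (all? (λ x → T? (x ∈ᵇ insert x ∅)) allV)

∈ᵇ-insert : ∀ x s y → y ∈ᵇ insert x s ≡ y ∈ᵇ insert x ∅ ∨ y ∈ᵇ s
∈ᵇ-insert x s y = trans (cong (y ∈ᵇ_) (insert≡∪ x s)) (∈ᵇ-∪ y (insert x ∅) s)

∈ᵇ-insert-here : ∀ x s → T (x ∈ᵇ insert x s)
∈ᵇ-insert-here x s =
  subst T (sym (∈ᵇ-insert x s x)) (Equivalence.from T-∨ (inj₁ (All.lookup ∈ᵇ-singleton (∈-allV x))))

∈ᵇ-insert-there : ∀ x s {y} → T (y ∈ᵇ s) → T (y ∈ᵇ insert x s)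
∈ᵇ-insert-there x s {y} y∈s = subst T (sym (∈ᵇ-insert x s y)) (Equivalence.from T-∨ (inj₂ y∈s))

vertexMarking : Marking V
vertexMarking = record
  { Mark        = VertexSet
  ; marked      = _∈ᵇ_
  ; mark        = insert
  ; marked-mark = ∈ᵇ-insert-here
  ; marked-mono = ∈ᵇ-insert-there
  }

open Graph nbs
open Search _≟_ vertexMarking allV 21

infixl 7 _·_
_·_ : V → V → V
a · b = rank (tabulate (λ i → lookup (perm a) (lookup (perm b) i)))

IsSymmetry : (V → V) → (V → V) → V → Set
IsSymmetry f g x =
  g (f x) ≡ x × f (g x) ≡ x × All (λ w → f w ∈ nbs (f x)) (nbs x) × All (λ w → g w ∈ nbs (g x)) (nbs x)

isSymmetry? : ∀ f g x → Dec (IsSymmetry f g x)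
isSymmetry? f g x =
  g (f x) ≟ x ×-dec f (g x) ≟ x ×-dec
  all? (λ w → f w ∈? nbs (f x)) (nbs x) ×-dec all? (λ w → g w ∈? nbs (g x)) (nbs x)

symmetry : ∀ f g → All (IsSymmetry f g) allV → Symmetry
symmetry f g checked = record
  { to       = f
  ; from     = g
  ; from-to  = λ x → proj₁ (at x)
  ; to-from  = λ x → proj₁ (proj₂ (at x))
  ; to-adj   = λ {v} → All.lookup (proj₁ (proj₂ (proj₂ (at v))))
  ; from-adj = λ {v} → All.lookup (proj₂ (proj₂ (proj₂ (at v))))
  }
  where
    at : ∀ x → IsSymmetry f g x
    at x = All.lookup checked (∈-allV x)

open Symmetry using (to; to-adj)

opaque
  translations : All (λ a → Any (λ b → b · a ≡ v0 × All (IsSymmetry (b ·_) (a ·_)) allV) allV) allV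
  translations =
    from-yes (all? (λ a → any? (λ b → b · a ≟ v0 ×-dec all? (isSymmetry? (b ·_) (a ·_)) allV) allV) allV)

translation : ∀ a → Σ[ σ ∈ Symmetry ] to σ a ≡ v0
translation a =
  let b , _ , b·a≡v0 , checked = find (All.lookup translations (∈-allV a))
  in symmetry (b ·_) (a ·_) checked , b·a≡v0

-- The search below only finds involutions c, for which this is conjugation by c.
conjugate : V → V → V
conjugate c x = c · (x · c)

opaque
  reflections : All (λ t → Any (λ c → conjugate c v0 ≡ v0 × conjugate c t ≡ v6 ×
                                      All (IsSymmetry (conjugate c) (conjugate c)) allV) allV) (nbs v0)
  reflections =
    from-yes (all? (λ t → any? (λ c → conjugate c v0 ≟ v0 ×-dec conjugate c t ≟ v6 ×-dec
                                      all? (isSymmetry? (conjugate c) (conjugate c)) allV) allV) (nbs v0))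

edge-symmetry : ∀ {a b} → b ∈ nbs a → Σ[ σ ∈ Symmetry ] to σ a ≡ v0 × to σ b ≡ v6
edge-symmetry {a} {b} b∈nbs-a =
  let τ , τa≡v0 = translation a
      c , _ , c-fixes-v0 , c-sends-τb , checked =
        find (All.lookup reflections (subst (λ z → to τ b ∈ nbs z) τa≡v0 (to-adj τ b∈nbs-a)))
  in symmetry (conjugate c) (conjugate c) checked ∘ˢ τ , trans (cong (conjugate c) τa≡v0) c-fixes-v0 , c-sends-τb

unrestricted : V → List V → Bool
unrestricted _ _ = true

nonadjacent? : ∀ x acc → Dec (All (λ y → x ∉ nbs y) acc)
nonadjacent? x = all? (λ y → x ∉? nbs y)

nonadjacent : V → List V → Bool
nonadjacent x acc = isYes (nonadjacent? x acc)

edge-candidates : List V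
edge-candidates = v1 ∷ v2 ∷ v3 ∷ v4 ∷ v5 ∷ v7 ∷ v8 ∷ v9 ∷ v10 ∷ v11 ∷ v12 ∷ v13 ∷ v14 ∷ v15 ∷ v16 ∷ v17 ∷ v18 ∷ v19 ∷ v20 ∷ v21 ∷ v22 ∷ v23 ∷ []

opaque
  edge-unique : Unique (edge-candidates ++ v6 ∷ v0 ∷ [])
  edge-unique = from-yes (unique? (edge-candidates ++ v6 ∷ v0 ∷ []))

  edge-covered : All (_∈ edge-candidates ++ v6 ∷ v0 ∷ []) allV
  edge-covered = from-yes (all? (_∈? edge-candidates ++ v6 ∷ v0 ∷ []) allV)

edge-search : Verified unrestricted edge-candidates 5 (v6 ∷ v0 ∷ []) (insert v6 (insert v0 ∅))
edge-search = refl

edge-case : ∀ {S} → v0 ∈ S → v6 ∈ S → length S ≤ 7 → LargeComponent 21 S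
edge-case {S} v0∈S v6∈S |S|≤7 =
  search-sound unrestricted {P = λ _ → ⊤} (λ _ _ → tt) (λ _ → tt) edge-candidates (v6 ∷ v0 ∷ []) (insert v6 (insert v0 ∅)) 5
    edge-unique (tt ∷ tt ∷ []) edge-search acc⊆S (λ {y} _ → All.lookup edge-covered (∈-allV y)) |S|≤7 tt
  where
    acc⊆S : v6 ∷ v0 ∷ [] ⊆ S
    acc⊆S (here refl)         = v6∈S
    acc⊆S (there (here refl)) = v0∈S

independent-candidates : List V
independent-candidates = v3 ∷ v4 ∷ v5 ∷ v7 ∷ v8 ∷ v9 ∷ v10 ∷ v11 ∷ v12 ∷ v13 ∷ v14 ∷ v15 ∷ v16 ∷ v17 ∷ v18 ∷ v19 ∷ v20 ∷ v22 ∷ v23 ∷ []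

opaque
  independent-unique : Unique (independent-candidates ++ v0 ∷ [])
  independent-unique = from-yes (unique? (independent-candidates ++ v0 ∷ []))

  independent-covered : All (λ v → v ∈ nbs v0 ⊎ v ∈ independent-candidates ++ v0 ∷ []) allV
  independent-covered = from-yes (all? (λ v → v ∈? nbs v0 ⊎-dec v ∈? independent-candidates ++ v0 ∷ []) allV)

independent-search : Verified nonadjacent independent-candidates 6 (v0 ∷ []) (insert v0 ∅)
independent-search = refl

independent-case : ∀ {S} → v0 ∈ S → Independent S → length S ≤ 7 → LargeComponent 21 S
independent-case {S} v0∈S indep |S|≤7 =
  search-sound nonadjacent Independent-resp-⊇
    (λ indep′ → fromWitness (All.tabulate λ y∈acc → indep′ (there y∈acc) (here refl)))
    independent-candidates (v0 ∷ []) (insert v0 ∅) 6 independent-unique (tt ∷ []) independent-search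
    (λ { (here refl) → v0∈S }) S⊆ |S|≤7 indep
  where
    S⊆ : S ⊆ independent-candidates ++ v0 ∷ []
    S⊆ {y} y∈S with All.lookup independent-covered (∈-allV y)
    ... | inj₁ y∈nbs = ⊥-elim (indep v0∈S y∈S y∈nbs)
    ... | inj₂ y∈    = y∈

length≤7⇒largeComponent : ∀ S → length S ≤ 7 → LargeComponent 21 S
length≤7⇒largeComponent []          _     = largeComponentᵇ-sound {m = ∅} [] tt
length≤7⇒largeComponent S@(a ∷ _) |S|≤7 with edge-or-independent _≟_ S
... | inj₁ (a′ , b , a′∈S , b∈S , b∈nbs-a′) =
  let σ , σa′≡v0 , σb≡v6 = edge-symmetry b∈nbs-a′ in
  largeComponent-pull σ
    (edge-case (∈-map-to σ a′∈S σa′≡v0) (∈-map-to σ b∈S σb≡v6) (subst (_≤ 7) (sym (length-map _ S)) |S|≤7))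
... | inj₂ indep =
  let τ , τa≡v0 = translation a in
  largeComponent-pull τ
    (independent-case (∈-map-to τ {x = a} (here refl) τa≡v0) (Independent-to τ indep) (subst (_≤ 7) (sym (length-map _ S)) |S|≤7))

Step : Word → Word → Set
Step g h = h ≡ g ·⟨ 0F , 1F ⟩ ⊎ h ≡ g ·⟨ 1F , 2F ⟩ ⊎ h ≡ g ·⟨ 2F , 3F ⟩ ⊎ h ≡ g ·⟨ 0F , 3F ⟩

step? : ∀ g h → Dec (Step g h)
step? g h = h ≟ʷ g ·⟨ 0F , 1F ⟩ ⊎-dec h ≟ʷ g ·⟨ 1F , 2F ⟩ ⊎-dec h ≟ʷ g ·⟨ 2F , 3F ⟩ ⊎-dec h ≟ʷ g ·⟨ 0F , 3F ⟩

Step⇒Adj : ∀ {g h} → Step g h → Adj g h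
Step⇒Adj (inj₁ eq)               = adj t12 eq
Step⇒Adj (inj₂ (inj₁ eq))        = adj t23 eq
Step⇒Adj (inj₂ (inj₂ (inj₁ eq))) = adj t34 eq
Step⇒Adj (inj₂ (inj₂ (inj₂ eq))) = adj t14 eq

opaque
  allV-steps : All (λ v → All (λ w → Step (perm v) (perm w)) (nbs v)) allV
  allV-steps = from-yes (all? (λ v → all? (λ w → step? (perm v) (perm w)) (nbs v)) allV)

  allV-perms : All (λ v → IsPerm (perm v)) allV
  allV-perms = from-yes (all? (λ v → DecUnique.unique? Fin._≟_ (toList (perm v))) allV)

nbs-Adj : ∀ {v w} → w ∈ nbs v → Adj (perm v) (perm w)
nbs-Adj {v} w∈nbs = Step⇒Adj (All.lookup (All.lookup allV-steps (∈-allV v)) w∈nbs)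

perm-IsPerm : ∀ v → IsPerm (perm v)
perm-IsPerm v = All.lookup allV-perms (∈-allV v)

module _ (F : List Word) where
  open DecMembership _≟ʷ_ using () renaming (_∈?_ to _∈ʷ?_)

  removed : List V
  removed = filter (λ v → perm v ∈ʷ? F) allV

  perm-∉ : ∀ {v} → v ∉ removed → perm v ∉ F
  perm-∉ {v} v∉removed perm-v∈F = v∉removed (∈-filter⁺ (λ v → perm v ∈ʷ? F) (∈-allV v) perm-v∈F)

  removed-length : length removed ≤ length F
  removed-length = subst (_≤ length F) (length-map perm removed)
    (unique-⊆-length≤ (Unique.map⁺ perm-injective (Unique.filter⁺ (λ v → perm v ∈ʷ? F) allV-unique)) perm-removed⊆F)
    where
      perm-removed⊆F : map perm removed ⊆ F
      perm-removed⊆F w∈ with ∈-map⁻ perm w∈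
      ... | v , v∈removed , refl = proj₂ (∈-filter⁻ (λ v → perm v ∈ʷ? F) {xs = allV} v∈removed)

  Reachable⇒Reach : ∀ {u w} → Reachable removed u w → Reach F (perm u) (perm w)
  Reachable⇒Reach (start u∉)           = here (perm-IsPerm _ , perm-∉ u∉)
  Reachable⇒Reach (step r w∈nbs w∉)    = step (Reachable⇒Reach r) (nbs-Adj w∈nbs) (perm-IsPerm _ , perm-∉ w∉)

∸-≤ : ∀ {k c s f} → k ≤ c + s → s ≤ f → k ∸ f ≤ c
∸-≤ {k} {c} {s} {f} k≤c+s s≤f =
  m≤n+o⇒m∸n≤o k f (≤-trans k≤c+s (≤-trans (+-monoʳ-≤ c s≤f) (≤-reflexive (+-comm c f))))

lemma2p9 : (F : List Word) → Unique F → All IsPerm F → length F ≤ 7 →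
    Disconnected F →
    Σ Word λ u → InGraph F u × ComponentSize≥ F u ((4 !) ∸ length F ∸ 3)
lemma2p9 F _ _ |F|≤7 _ =
  let u , u∉ , C , C-unique , C-reachable , 21≤ = length≤7⇒largeComponent (removed F) (≤-trans (removed-length F) |F|≤7)
  in perm u , (perm-IsPerm u , perm-∉ F u∉) , map perm C , Unique.map⁺ perm-injective C-unique ,
     All.map⁺ (All.map (Reachable⇒Reach F) C-reachable) , size-bound C 21≤
  where
    open ≤-Reasoning
    size-bound : ∀ C → 21 ≤ length C + length (removed F) → (4 !) ∸ length F ∸ 3 ≤ length (map perm C)
    size-bound C 21≤ = begin
      24 ∸ length F ∸ 3    ≡⟨ ∸-+-assoc 24 (length F) 3 ⟩
      24 ∸ (length F + 3)  ≡⟨ cong (24 ∸_) (+-comm (length F) 3) ⟩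
      21 ∸ length F        ≤⟨ ∸-≤ 21≤ (removed-length F) ⟩
      length C             ≡⟨ sym (length-map perm C) ⟩
      length (map perm C)  ∎
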